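{- Let $\mathsf M,\mathsf M',\mathsf N,\mathsf N'$ be EAMs. (1) $\to_{\mathsf c}$ is deterministic: if $\mathsf M\to_{\mathsf c}\mathsf N$ and $\mathsf M\to_{\mathsf c}\mathsf N'$ then $\mathsf N=\mathsf N'$. (2) $\to_{\mathsf c}$ is Church–Rosser: $\mathsf M\leftrightarrow_{\mathsf c}\mathsf N$ iff there is an EAM $\mathsf Z$ with $\mathsf M\twoheadrightarrow_{\mathsf c}\mathsf Z$ and $\mathsf N\twoheadrightarrow_{\mathsf c}\mathsf Z$. (3) If $\mathsf M\twoheadrightarrow_{\mathsf c}\mathsf M'$ then $\mathsf M@[\#\mathsf N]\twoheadrightarrow_{\mathsf c}\mathsf M'@[\#\mathsf N]$.
   Context: Fix a countably infinite set $\mathbb A$ of addresses with $\mathbb N\subseteq\mathbb A$, $\mathbb A\setminus\mathbb N$ infinite, and $\varnothing\notin\mathbb A$. Tapes are finite lists of addresses ($a::T$ cons, $T@T'$ concatenation). Programs: $P::=\mathtt{Load}\,i;P\mid A$, $A::=\mathtt{App}(i,j,k);A\mid\mathtt{Test}(i,j,k,l);A\mid\mathtt{Pred}(i,j);A\mid\mathtt{Succ}(i,j);A\mid C$, $C::=\mathtt{Call}\,i\mid\varepsilon$. An EAM is $\langle R_0,\dots,R_r,P,T\rangle$ with $!R_i\in\mathbb A\cup\{\varnothing\}$ and a valid program (never reads an uninitialised or nonexistent register, never writes via App/Pred/Succ/Test to a nonexistent register; Load into a nonexistent register discards the value). $\vec R[R_i:=a]$ updates register $i$ (no effect if nonexistent);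 $\mathsf M@T'=\langle\vec R,P,T@T'\rangle$. Numeral machines $\mathsf n=\langle R_0=n,\varepsilon,[]\rangle$; $\mathsf Y^a=\langle R_0=\varnothing,R_1=\varnothing,\mathtt{Load}\,0;\mathtt{Load}\,1;\mathtt{App}(0,1,0);\mathtt{App}(1,0,1);\mathtt{Call}\,1,[a]\rangle$. A fixed bijection $\#$ from the set of EAMs onto $\mathbb A$ satisfies $\#\mathsf n=n$ and $\#(\mathsf Y^a)=a$ for some $a\in\mathbb A\setminus\mathbb N$; $a\cdot b=\#(\#^{ -1}(a)@[b])$. Reduction $\to_{\mathsf c}$: $\langle\vec R,\mathtt{Call}\,i,T\rangle\to\#^{ -1}(!R_i)@T$; $\langle\vec R,\mathtt{Load}\,i;P,a::T\rangle\to\langle\vec R[R_i:=a],P,T\rangle$; $\langle\vec R,\mathtt{App}(i,j,k);P,T\rangle\to\langle\vec R[R_k:=!R_i\cdot!R_j],P,T\rangle$; if $!R_i\in\mathbb N$: $\langle\vec R,\mathtt{Pred}(i,j);P,T\rangle\to\langle\vec R[R_j:=\max(!R_i-1,0)],P,T\rangle$, $\langle\vec R,\mathtt{Succ}(i,j);P,T\rangle\to\langle\vec R[R_j:=!R_i+1],P,T\rangle$, $\langle\vec R,\mathtt{Test}(i,j,k,l);P,T\rangle\to\langle\vec R[R_l:=!R_j],P,T\rangle$ if $!R_i=0$ and $\to\langle\vec R[R_l:=!R_k],P,T\rangle$ otherwise; if $\#^{ -1}(!R_i)\to_{\mathsf c}\mathsf M'$ and the first instruction is $\mathtt{Pred}(i,j)$,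 $\mathtt{Succ}(i,j)$ or $\mathtt{Test}(i,j,k,l)$, the machine steps to the same machine with $R_i:=\#\mathsf M'$. $\twoheadrightarrow_{\mathsf c}$ is the reflexive-transitive closure and $\leftrightarrow_{\mathsf c}$ the reflexive-symmetric-transitive closure of $\to_{\mathsf c}$. -}

module Defs where

open import Data.Nat using (ℕ; zero; suc; _∸_)
open import Data.Bool using (Bool; true; false; _∧_; T)
open import Data.Maybe using (Maybe; just; nothing; is-just)
open import Data.List using (List; []; _∷_; _++_; map)
open import Data.Product using (Σ; ∃; _×_; _,_)
open import Data.Unit using (tt)
open import Relation.Binary.PropositionalEquality using (_≡_)
open import Relation.Nullary using (¬_)

data Body : Set where
  App  : ℕ → ℕ → ℕ → Body → Body
  Test : ℕ → ℕ → ℕ → ℕ → Body → Body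
  Pred : ℕ → ℕ → Body → Body
  Succ : ℕ → ℕ → Body → Body
  Call : ℕ → Body
  ε    : Body

data Prog : Set where
  Load : ℕ → Prog → Prog
  ⌜_⌝  : Body → Prog

lookupR : {X : Set} → List X → ℕ → Maybe X
lookupR []       _       = nothing
lookupR (x ∷ xs) zero    = just x
lookupR (x ∷ xs) (suc i) = lookupR xs i

-- update register i; no effect if register i does not exist
updR : {X : Set} → List X → ℕ → X → List X
updR []       _       y = []
updR (x ∷ xs) zero    y = y ∷ xs
updR (x ∷ xs) (suc i) y = x ∷ updR xs i y

-- Validity. The Bool list records which registers are initialised.
exists : List Bool → ℕ → Bool
exists []       _       = false
exists (_ ∷ _)  zero    = true
exists (_ ∷ bs) (suc i) = exists bs i

initd : List Bool → ℕ → Bool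
initd []       _       = false
initd (b ∷ _)  zero    = b
initd (_ ∷ bs) (suc i) = initd bs i

validB : List Bool → Body → Bool
validB bs (App i j k A)    = initd bs i ∧ initd bs j ∧ exists bs k ∧ validB (updR bs k true) A
validB bs (Test i j k l A) = initd bs i ∧ initd bs j ∧ initd bs k ∧ exists bs l ∧ validB (updR bs l true) A
validB bs (Pred i j A)     = initd bs i ∧ exists bs j ∧ validB (updR bs j true) A
validB bs (Succ i j A)     = initd bs i ∧ exists bs j ∧ validB (updR bs j true) A
validB bs (Call i)         = initd bs i
validB bs ε                = true

validP : List Bool → Prog → Bool
validP bs (Load i P) = validP (updR bs i true) P
validP bs ⌜ A ⌝      = validB bs A

-- EAMs over a type of addresses Addr; ∅ is represented by 'nothing'.
module Machines (Addr : Set) (ι : ℕ → Addr) where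

  record EAM : Set where
    constructor ⟨_,_,_∣_⟩
    field
      regs  : List (Maybe Addr)
      prog  : Prog
      tape  : List Addr
      valid : T (validP (map is-just regs) prog)
  open EAM public

  _＠_ : EAM → List Addr → EAM
  ⟨ R , P , T₀ ∣ v ⟩ ＠ T' = ⟨ R , P , T₀ ++ T' ∣ v ⟩

  numeral : ℕ → EAM
  numeral n = ⟨ just (ι n) ∷ [] , ⌜ ε ⌝ , [] ∣ tt ⟩

  Ymach : Addr → EAM
  Ymach a = ⟨ nothing ∷ nothing ∷ [] ,
              Load 0 (Load 1 ⌜ App 0 1 0 (App 1 0 1 (Call 1)) ⌝) ,
              a ∷ [] ∣ tt ⟩

  record Coding : Set where
    field
      ♯     : EAM → Addr
      ♯⁻¹   : Addr → EAM
      ♯⁻¹∘♯ : ∀ M → ♯⁻¹ (♯ M) ≡ M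
      ♯∘♯⁻¹ : ∀ a → ♯ (♯⁻¹ a) ≡ a
      ♯-num : ∀ n → ♯ (numeral n) ≡ ι n
      ♯-Y   : ∃ λ a → (∀ n → ¬ (ι n ≡ a)) × ♯ (Ymach a) ≡ a

  module Reduction (C : Coding) where
    open Coding C

    _·_ : Addr → Addr → Addr
    a · b = ♯ (♯⁻¹ a ＠ (b ∷ []))

    -- !R_i = a  (register i exists and is initialised with a)
    _!_≡_ : List (Maybe Addr) → ℕ → Addr → Set
    R ! i ≡ a = lookupR R i ≡ just (just a)

    data ReadsNum (i : ℕ) : Body → Set where
      rPred : ∀ j A → ReadsNum i (Pred i j A)
      rSucc : ∀ j A → ReadsNum i (Succ i j A)
      rTest : ∀ j k l A → ReadsNum i (Test i j k l A)

    infix 4 _→c_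
    data _→c_ (M : EAM) : EAM → Set where
      call : ∀ {i a N} → prog M ≡ ⌜ Call i ⌝ → regs M ! i ≡ a →
             N ≡ ♯⁻¹ a ＠ tape M → M →c N
      load : ∀ {i P a T' N} → prog M ≡ Load i P → tape M ≡ a ∷ T' →
             regs N ≡ updR (regs M) i (just a) → prog N ≡ P → tape N ≡ T' → M →c N
      app  : ∀ {i j k A a b N} → prog M ≡ ⌜ App i j k A ⌝ →
             regs M ! i ≡ a → regs M ! j ≡ b →
             regs N ≡ updR (regs M) k (just (a · b)) → prog N ≡ ⌜ A ⌝ → tape N ≡ tape M → M →c N
      pred : ∀ {i j A n N} → prog M ≡ ⌜ Pred i j A ⌝ → regs M ! i ≡ ι n →
             regs N ≡ updR (regs M) j (just (ι (n ∸ 1))) → prog N ≡ ⌜ A ⌝ → tape N ≡ tape M → M →c N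
      succ : ∀ {i j A n N} → prog M ≡ ⌜ Succ i j A ⌝ → regs M ! i ≡ ι n →
             regs N ≡ updR (regs M) j (just (ι (suc n))) → prog N ≡ ⌜ A ⌝ → tape N ≡ tape M → M →c N
      test0 : ∀ {i j k l A b N} → prog M ≡ ⌜ Test i j k l A ⌝ → regs M ! i ≡ ι 0 →
              regs M ! j ≡ b →
              regs N ≡ updR (regs M) l (just b) → prog N ≡ ⌜ A ⌝ → tape N ≡ tape M → M →c N
      testS : ∀ {i j k l A n c N} → prog M ≡ ⌜ Test i j k l A ⌝ → regs M ! i ≡ ι (suc n) →
              regs M ! k ≡ c →
              regs N ≡ updR (regs M) l (just c) → prog N ≡ ⌜ A ⌝ → tape N ≡ tape M → M →c N
      inner : ∀ {i A a M' N} → prog M ≡ ⌜ A ⌝ → ReadsNum i A → regs M ! i ≡ a →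
              ♯⁻¹ a →c M' →
              regs N ≡ updR (regs M) i (just (♯ M')) → prog N ≡ prog M → tape N ≡ tape M → M →c N

-- The first instruction of a machine's program determines which rule can fire,
-- and each rule determines its result from the registers and the tape; the
-- only overlap, between a rule reading a numeral and the rule reducing that
-- register's machine in place, is void because numeral machines are in normal
-- form. A deterministic relation is confluent, and for a confluent relation
-- convertibility is joinability. Appending to the tape commutes with every rule.

module Submission where

open import Defs
open import Data.Nat using (ℕ; suc; _∸_)
open import Data.List using (List; []; _∷_; _++_)
open import Data.List.Properties using (++-assoc)
open import Data.List.Membership.Propositional using (_∉_)
open import Data.Maybe using (Maybe; just)
open import Data.Bool.Properties using (T-irrelevant)
open import Data.Empty using (⊥; ⊥-elim)
open import Data.Product using (∃; ∃₂; _×_; _,_; -,_)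
open import Data.Sum using (_⊎_; inj₁; inj₂)
open import Function.Bundles using (_⤖_; _⇔_; mk⇔)
open import Function.Definitions using (Injective)
open import Relation.Nullary using (¬_)
open import Relation.Binary.Core using (Rel)
open import Relation.Binary.PropositionalEquality using (_≡_; refl; sym; trans; cong; subst)
open import Relation.Binary.Rewriting using (Confluent; Deterministic; det⇒conf)
open import Relation.Binary.Construct.Closure.ReflexiveTransitive as Star using (Star; ε; _◅_; _◅◅_)
open import Relation.Binary.Construct.Closure.Equivalence using (EqClosure)
open import Relation.Binary.Construct.Closure.Equivalence.Properties using (a—↠b⇒a↔b; a—↠b⇒b↔a)
open import Relation.Binary.Construct.Closure.Symmetric using (fwd; bwd)

module _ {a ℓ} {A : Set a} {_⟶_ : Rel A ℓ} where

  conf⇒↔⇔joinable : Confluent _⟶_ → ∀ {x y} →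
    EqClosure _⟶_ x y ⇔ (∃ λ z → Star _⟶_ x z × Star _⟶_ y z)
  conf⇒↔⇔joinable conf = mk⇔ joinable (λ (_ , xz , yz) → a—↠b⇒a↔b xz ◅◅ a—↠b⇒b↔a yz)
    where
    joinable : ∀ {x y} → EqClosure _⟶_ x y → ∃ λ z → Star _⟶_ x z × Star _⟶_ y z
    joinable ε = -, ε , ε
    joinable (fwd r ◅ e) with joinable e
    ... | z , x′z , yz = z , r ◅ x′z , yz
    joinable (bwd r ◅ e) with joinable e
    ... | z , x′z , yz with conf (r ◅ ε) x′z
    ...   | d , xd , zd = d , xd , yz ◅◅ zd

module EAMReduction (Addr : Set) (ι : ℕ → Addr) (ι-injective : Injective _≡_ _≡_ ι)
                    (C : Machines.Coding Addr ι) where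
  open Machines Addr ι
  open Coding C
  open Reduction C

  HasComponents : EAM → List (Maybe Addr) → Prog → List Addr → Set
  HasComponents N R P T = regs N ≡ R × prog N ≡ P × tape N ≡ T

  HasComponents-unique : ∀ {N N′ R P T} →
    HasComponents N R P T → HasComponents N′ R P T → N ≡ N′
  HasComponents-unique {⟨ R , P , T ∣ v ⟩} {⟨ .R , .P , .T ∣ w ⟩}
                       (refl , refl , refl) (refl , refl , refl) =
    cong ⟨ R , P , T ∣_⟩ (T-irrelevant v w)

  !-functional : ∀ {x : Maybe (Maybe Addr)} {a b} →
    x ≡ just (just a) → x ≡ just (just b) → a ≡ b
  !-functional r r′ with refl ← trans (sym r) r′ = refl

  Writes : EAM → ℕ → Addr → Body → EAM → Set
  Writes M k v A N = HasComponents N (updR (regs M) k (just v)) ⌜ A ⌝ (tape M)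

  InnerStep : EAM → ℕ → EAM → Set
  InnerStep M i N = ∃₂ λ a M′ → regs M ! i ≡ a × ♯⁻¹ a →c M′ ×
    HasComponents N (updR (regs M) i (just (♯ M′))) (prog M) (tape M)

  Redex : EAM → Prog → EAM → Set
  Redex M (Load i P) N = ∃₂ λ a T′ → tape M ≡ a ∷ T′ ×
    HasComponents N (updR (regs M) i (just a)) P T′
  Redex M ⌜ Call i ⌝ N = ∃ λ a → regs M ! i ≡ a × N ≡ ♯⁻¹ a ＠ tape M
  Redex M ⌜ App i j k A ⌝ N =
    ∃₂ λ a b → regs M ! i ≡ a × regs M ! j ≡ b × Writes M k (a · b) A N
  Redex M ⌜ Pred i j A ⌝ N =
    (∃ λ n → regs M ! i ≡ ι n × Writes M j (ι (n ∸ 1)) A N) ⊎ InnerStep M i N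
  Redex M ⌜ Succ i j A ⌝ N =
    (∃ λ n → regs M ! i ≡ ι n × Writes M j (ι (suc n)) A N) ⊎ InnerStep M i N
  Redex M ⌜ Test i j k l A ⌝ N =
    ((∃ λ b → regs M ! i ≡ ι 0 × regs M ! j ≡ b × Writes M l b A N)
     ⊎ (∃₂ λ n c → regs M ! i ≡ ι (suc n) × regs M ! k ≡ c × Writes M l c A N))
    ⊎ InnerStep M i N
  Redex M ⌜ ε ⌝ N = ⊥

  invert : ∀ {M N} → M →c N → Redex M (prog M) N
  invert (call refl r e)                            = -, r , e
  invert (load refl t rN pN tN)                     = -, -, t , rN , pN , tN
  invert (app refl r s rN pN tN)                    = -, -, r , s , rN , pN , tN
  invert (pred refl r rN pN tN)                     = inj₁ (-, r , rN , pN , tN)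
  invert (succ refl r rN pN tN)                     = inj₁ (-, r , rN , pN , tN)
  invert (test0 refl r s rN pN tN)                  = inj₁ (inj₁ (-, r , s , rN , pN , tN))
  invert (testS refl r s rN pN tN)                  = inj₁ (inj₂ (-, -, r , s , rN , pN , tN))
  invert (inner refl (rPred _ _) r t rN pN tN)     = inj₂ (-, -, r , t , rN , pN , tN)
  invert (inner refl (rSucc _ _) r t rN pN tN)     = inj₂ (-, -, r , t , rN , pN , tN)
  invert (inner refl (rTest _ _ _ _) r t rN pN tN) = inj₂ (-, -, r , t , rN , pN , tN)

  numeral-or-inner : ∀ {M N i A} → ReadsNum i A → Redex M ⌜ A ⌝ N →
    (∃ λ n → regs M ! i ≡ ι n) ⊎ InnerStep M i N
  numeral-or-inner (rPred _ _)     (inj₁ (_ , r , _))             = inj₁ (-, r)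
  numeral-or-inner (rSucc _ _)     (inj₁ (_ , r , _))             = inj₁ (-, r)
  numeral-or-inner (rTest _ _ _ _) (inj₁ (inj₁ (_ , r , _)))      = inj₁ (-, r)
  numeral-or-inner (rTest _ _ _ _) (inj₁ (inj₂ (_ , _ , r , _))) = inj₁ (-, r)
  numeral-or-inner (rPred _ _)     (inj₂ step)                  = inj₂ step
  numeral-or-inner (rSucc _ _)     (inj₂ step)                  = inj₂ step
  numeral-or-inner (rTest _ _ _ _) (inj₂ step)                  = inj₂ step

  numeral-normal : ∀ {n N} → ¬ (numeral n →c N)
  numeral-normal = invert

  ♯⁻¹ι-normal : ∀ {n N} → ¬ (♯⁻¹ (ι n) →c N)
  ♯⁻¹ι-normal {n} = subst (λ M → ¬ (M →c _))
    (trans (sym (♯⁻¹∘♯ (numeral n))) (cong ♯⁻¹ (♯-num n))) numeral-normal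

  numeral-content-normal : ∀ {x : Maybe (Maybe Addr)} {n a M′} →
    x ≡ just (just (ι n)) → x ≡ just (just a) → ¬ (♯⁻¹ a →c M′)
  numeral-content-normal r r′ with refl ← !-functional r r′ = ♯⁻¹ι-normal

  →c-deterministic : Deterministic _≡_ _→c_
  →c-deterministic (call refl r refl) s′ with _ , r′ , refl ← invert s′
    with refl ← !-functional r r′ = refl
  →c-deterministic (load refl refl rN pN tN) s′ with _ , _ , refl , c′ ← invert s′ =
    HasComponents-unique (rN , pN , tN) c′
  →c-deterministic (app refl r s rN pN tN) s′ with _ , _ , r′ , s″ , c′ ← invert s′
    with refl ← !-functional r r′ | refl ← !-functional s s″ =
    HasComponents-unique (rN , pN , tN) c′
  →c-deterministic (pred refl r rN pN tN) s′ with invert s′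
  ... | inj₁ (_ , r′ , c′) with refl ← ι-injective (!-functional r r′) =
    HasComponents-unique (rN , pN , tN) c′
  ... | inj₂ (_ , _ , r′ , t , _) = ⊥-elim (numeral-content-normal r r′ t)
  →c-deterministic (succ refl r rN pN tN) s′ with invert s′
  ... | inj₁ (_ , r′ , c′) with refl ← ι-injective (!-functional r r′) =
    HasComponents-unique (rN , pN , tN) c′
  ... | inj₂ (_ , _ , r′ , t , _) = ⊥-elim (numeral-content-normal r r′ t)
  →c-deterministic (test0 refl r s rN pN tN) s′ with invert s′
  ... | inj₁ (inj₁ (_ , _ , s″ , c′)) with refl ← !-functional s s″ =
    HasComponents-unique (rN , pN , tN) c′
  ... | inj₁ (inj₂ (_ , _ , r′ , _)) with () ← ι-injective (!-functional r r′)
  ... | inj₂ (_ , _ , r′ , t , _) = ⊥-elim (numeral-content-normal r r′ t)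
  →c-deterministic (testS refl r s rN pN tN) s′ with invert s′
  ... | inj₁ (inj₁ (_ , r′ , _)) with () ← ι-injective (!-functional r r′)
  ... | inj₁ (inj₂ (_ , _ , _ , s″ , c′)) with refl ← !-functional s s″ =
    HasComponents-unique (rN , pN , tN) c′
  ... | inj₂ (_ , _ , r′ , t , _) = ⊥-elim (numeral-content-normal r r′ t)
  →c-deterministic (inner refl rn r t rN pN tN) s′ with numeral-or-inner rn (invert s′)
  ... | inj₁ (_ , r′) = ⊥-elim (numeral-content-normal r′ r t)
  ... | inj₂ (_ , _ , r′ , t′ , c′) with refl ← !-functional r r′
    with refl ← →c-deterministic t t′ = HasComponents-unique (rN , pN , tN) c′

  ＠-++ : ∀ M T T′ → (M ＠ T) ＠ T′ ≡ M ＠ (T ++ T′)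
  ＠-++ M T T′ = HasComponents-unique (refl , refl , ++-assoc (tape M) T T′) (refl , refl , refl)

  →c-＠ : ∀ {M N} T → M →c N → M ＠ T →c N ＠ T
  →c-＠ T (call {a = a} p r e)       = call p r (trans (cong (_＠ T) e) (＠-++ (♯⁻¹ a) _ T))
  →c-＠ T (load p t rN pN tN)        = load p (cong (_++ T) t) rN pN (cong (_++ T) tN)
  →c-＠ T (app p r s rN pN tN)       = app p r s rN pN (cong (_++ T) tN)
  →c-＠ T (pred p r rN pN tN)        = pred p r rN pN (cong (_++ T) tN)
  →c-＠ T (succ p r rN pN tN)        = succ p r rN pN (cong (_++ T) tN)
  →c-＠ T (test0 p r s rN pN tN)     = test0 p r s rN pN (cong (_++ T) tN)
  →c-＠ T (testS p r s rN pN tN)     = testS p r s rN pN (cong (_++ T) tN)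
  →c-＠ T (inner p rn r t rN pN tN)  = inner p rn r t rN pN (cong (_++ T) tN)

lemma3p11 : (Addr : Set) (ι : ℕ → Addr) →
    Injective _≡_ _≡_ ι →
    Addr ⤖ ℕ →
    (∀ (xs : List Addr) → ∃ λ a → a ∉ xs × (∀ n → ¬ (ι n ≡ a))) →
    (C : Machines.Coding Addr ι) →
    let open Machines Addr ι in
    let open Coding C in
    let open Reduction C in
    (∀ {M N N'} → M →c N → M →c N' → N ≡ N')
    × (∀ {M N} → EqClosure _→c_ M N ⇔ (∃ λ Z → Star _→c_ M Z × Star _→c_ N Z))
    × (∀ {M M'} N → Star _→c_ M M' → Star _→c_ (M ＠ (♯ N ∷ [])) (M' ＠ (♯ N ∷ [])))
lemma3p11 Addr ι ι-injective _ _ C =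
    →c-deterministic
  , conf⇒↔⇔joinable (det⇒conf →c-deterministic)
  , λ N → Star.gmap _ (→c-＠ _)
  where open EAMReduction Addr ι ι-injective C
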